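{- Let $\Delta = \Delta(\mathcal{X})$ be the EM simplex on a family $\mathcal{X}=(X_0,\ldots,X_d)$ of finite sets. Then for all integers $i\ge0$, \[{\rm Vol}_i(\Delta) = \sum_{x\in\cup\mathcal{X}} (\#\epsilon(x))_i,\] where $(a)_i = a(a-1)\cdots(a-i+1)$ is the falling factorial. In particular: (a) ${\rm Vol}_0(\Delta) = |\cup\mathcal{X}|$; (b) ${\rm Vol}(\Delta) = \sum_x \#\epsilon(x) = |\blacktriangle(\mathcal{X})|$; (c) ${\rm Vol}_2(\Delta) = \sum_x \#\epsilon(x)\cdot\dim\epsilon(x)$.
   Context: Let $d \geq 0$ and $\mathcal{X} = (X_0, \ldots, X_d)$ a family of finite sets (repetitions allowed; vertices indexed by $0,\dots,d$). Write $\cup\mathcal{X} = \bigcup_i X_i$ and $\deg_{\mathcal{X}}(x) = \#\{i : x \in X_i\}$. The abstract $d$-simplex $\Delta(\mathcal{X})$ has as faces all subsets $\mathcal{F}$ of $\{X_0,\dots,X_d\}$ (including $\varnothing$), $\dim\mathcal{F}=\#\mathcal{F}-1$; a cofacet of $\mathcal{F}$ is a face $\mathcal{G}\supset\mathcal{F}$ with $\#\mathcal{G}=\#\mathcal{F}+1$. Define $\epsilon(x) = \{X_i : x \in X_i\}$ if $\deg_{\mathcal{X}}(x)\le (d+1)/2$ and $\epsilon(x) = \{X_i : x \notin X_i\}$ if $\deg_{\mathcal{X}}(x)> (d+1)/2$. Labelings: for faces with $\dim \mathcal{F}\le\lfloor(d-1)/2\rfloor$, $\lambda^{(0)}(\mathcal{F})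 = \{x : \epsilon(x) = \mathcal{F}\}$; for faces with $\dim\mathcal{F} \le \lfloor (d-1)/2\rfloor - (i+1)$, $\lambda^{(i+1)}(\mathcal{F})$ is the multiset union of $\lambda^{(i)}(\mathcal{G})$ over all cofacets $\mathcal{G}$ of $\mathcal{F}$. The EM simplex is $\Delta(\mathcal{X})$ with these labelings; ${\rm Vol}_i(\Delta) = \sum_{\mathcal{F}} |\lambda^{(i)}(\mathcal{F})|$ (multiset cardinalities) over faces with $\dim\mathcal{F}\le\lfloor(d-1)/2\rfloor - i$, and ${\rm Vol}={\rm Vol}_1$. The generalized symmetric difference $\blacktriangle(\mathcal{X})$ is the multiset in which each $x\in\cup\mathcal{X}$ occurs with multiplicity $\min\{\deg_{\mathcal{X}}(x),\, d+1-\deg_{\mathcal{X}}(x)\}$. -}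

module Defs where

open import Data.Nat using (ℕ; zero; suc; _+_; _*_; _∸_; _≤_; _≤ᵇ_; _/_; _⊓_)
open import Data.Bool using (Bool; true; false; not; if_then_else_; _∧_)
import Data.Bool as B
open import Data.Fin using (Fin)
open import Data.Fin.Subset using (Subset; ⁅_⁆; _∪_; ∣_∣)
open import Data.Vec using (Vec; []; _∷_; lookup; tabulate)
open import Data.Vec.Properties using (≡-dec)
open import Data.List using (List; []; _∷_; map; filterᵇ; concatMap; length; allFin; _++_)
open import Data.Nat.ListAction using (sum)
open import Relation.Nullary.Decidable using (does)

-- A family X = (X_0, ..., X_d) of finite sets is modelled as a map
-- Fin (suc d) → Subset n : each X_i is a subset of the finite universe Fin n.
-- (Any finite family of finite sets lives in such a universe, namely its union.)
Family : ℕ → ℕ → Set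
Family d n = Fin (suc d) → Subset n

mem : ∀ {d n} → Family d n → Fin n → Fin (suc d) → Bool
mem X x i = lookup (X i) x

deg : ∀ {d n} → Family d n → Fin n → ℕ
deg {d} X x = length (filterᵇ (mem X x) (allFin (suc d)))

inUnion : ∀ {d n} → Family d n → Fin n → Bool
inUnion X x = 1 ≤ᵇ deg X x

unionList : ∀ {d n} → Family d n → List (Fin n)
unionList {n = n} X = filterᵇ (inUnion X) (allFin n)

-- ε(x) : a face of Δ(X), i.e. a subset of the vertex set {0,…,d}.
-- deg(x) ≤ (d+1)/2  ⇔  2·deg(x) ≤ d+1.
ε : ∀ {d n} → Family d n → Fin n → Subset (suc d)
ε {d} X x =
  if (2 * deg X x) ≤ᵇ suc d
  then tabulate (λ i → mem X x i)
  else tabulate (λ i → not (mem X x i))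

allSubsets : (m : ℕ) → List (Subset m)
allSubsets zero = [] ∷ []
allSubsets (suc m) = map (false ∷_) (allSubsets m) ++ map (true ∷_) (allSubsets m)

cofacets : ∀ {m} → Subset m → List (Subset m)
cofacets {m} F = map (λ j → F ∪ ⁅ j ⁆) (filterᵇ (λ j → not (lookup F j)) (allFin m))

_==ˢ_ : ∀ {m} → Subset m → Subset m → Bool
F ==ˢ G = does (≡-dec B._≟_ F G)

-- Labelings λ^(i)(F), multisets represented as lists (multiset union = _++_,
-- multiset cardinality = length).  The recursion formulas are used for all
-- faces; only the values on faces in the range allowed by the paper
-- (dim F ≤ ⌊(d-1)/2⌋ - i) enter Vol_i, and those agree with the paper's.
label : ∀ {d n} → Family d n → ℕ → Subset (suc d) → List (Fin n)
label X zero    F = filterᵇ (λ x → inUnion X x ∧ (ε X x ==ˢ F)) (unionList X)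
label X (suc i) F = concatMap (label X i) (cofacets F)

-- dim F ≤ ⌊(d-1)/2⌋ - i  ⇔  #F + i ≤ ⌊(d+1)/2⌋   (with dim F = #F - 1;
-- valid also for d = 0 where ⌊(d-1)/2⌋ = -1).
admissible : (d : ℕ) → ℕ → Subset (suc d) → Bool
admissible d i F = (∣ F ∣ + i) ≤ᵇ (suc d / 2)

Vol : ∀ {d n} → Family d n → ℕ → ℕ
Vol {d} X i = sum (map (λ F → length (label X i F))
                       (filterᵇ (admissible d i) (allSubsets (suc d))))

fall : ℕ → ℕ → ℕ
fall a zero = 1
fall zero (suc i) = 0
fall (suc a) (suc i) = suc a * fall a i

-- |▲(X)| : multiset cardinality of the generalized symmetric difference
symDiffCard : ∀ {d n} → Family d n → ℕ
symDiffCard {d} X = sum (map (λ x → deg X x ⊓ (suc d ∸ deg X x)) (unionList X))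

-- #ε(x) and dim ε(x) = #ε(x) - 1 (truncated; only used multiplied by #ε(x),
-- where the truncation at #ε(x)=0 is harmless since 0·(-1) = 0)
cardε : ∀ {d n} → Family d n → Fin n → ℕ
cardε X x = ∣ ε X x ∣

dimε : ∀ {d n} → Family d n → Fin n → ℕ
dimε X x = ∣ ε X x ∣ ∸ 1

-- Unfolding the recursion, |λ⁽ⁱ⁾(F)| counts pairs (x, c) with c a chain
-- F = F₀ ⊂ F₁ ⊂ ⋯ ⊂ Fᵢ = ε(x) of cofacet steps.  For fixed x there are i!
-- such chains from each F ⊆ ε(x) with |ε(x) ∖ F| = i, so (#ε(x))ᵢ chains in
-- all.  Since #ε(x) = min(deg x, d+1-deg x) ≤ ⌊(d+1)/2⌋, every such F is
-- admissible for Vol_i, so restricting the sum to admissible faces loses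
-- nothing.
module Submission where

open import Defs
open import Data.Nat using (ℕ; _*_)
open import Data.List using (map; length)
open import Data.Nat.ListAction using (sum)
open import Data.Product using (_×_)
open import Relation.Binary.PropositionalEquality using (_≡_)

open import Algebra.Properties.CommutativeSemigroup using (interchange)
open import Data.Bool using (Bool; true; false; not; if_then_else_; _∧_; T)
open import Data.Bool.Properties using (∨-identityʳ)
import Data.Bool as Bool
open import Data.Empty using (⊥-elim)
open import Data.Fin using (Fin; zero; suc)
open import Data.Fin.Subset using (Subset; ⁅_⁆; _∪_; ∣_∣; ∁)
open import Data.Fin.Subset.Properties using (∪-identityʳ; ∣∁p∣≡n∸∣p∣; ∣p∣≤n)
open import Data.List as List using (List; []; _∷_; _++_; filterᵇ; concatMap; allFin)
open import Data.List.Properties using (map-cong; map-∘; map-++; length-++; map-tabulate)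
open import Data.Nat as ℕ using (zero; suc; _+_; _∸_; _≤_; _≤ᵇ_; _/_; _⊓_)
open import Data.Nat.DivMod using (/-monoˡ-≤; m*n/n≡m)
open import Data.Nat.ListAction.Properties using (sum-++)
open import Data.Nat.Properties
open import Data.Nat.Solver using (module +-*-Solver)
open +-*-Solver using (solve; _:+_; _:*_; _:=_; con)
open import Data.Product using (_,_)
open import Data.Vec as Vec using ([]; _∷_; lookup)
open import Data.Vec.Properties using (≡-dec; tabulate-∘)
open import Function using (_∘_; id)
open import Relation.Binary.PropositionalEquality
  using (_≢_; refl; sym; trans; cong; cong₂; subst; module ≡-Reasoning)
open import Relation.Nullary using (yes; no; ofʸ; ofⁿ)

module _ {A : Set} where

  sum-map-cong : {f g : A → ℕ} → (∀ x → f x ≡ g x) → (xs : List A) →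
                 sum (map f xs) ≡ sum (map g xs)
  sum-map-cong f≗g xs = cong sum (map-cong f≗g xs)

  sum-map-zero : (xs : List A) → sum (map (λ _ → 0) xs) ≡ 0
  sum-map-zero []       = refl
  sum-map-zero (x ∷ xs) = sum-map-zero xs

  sum-map-one : (xs : List A) → sum (map (λ _ → 1) xs) ≡ length xs
  sum-map-one []       = refl
  sum-map-one (x ∷ xs) = cong suc (sum-map-one xs)

  sum-map-+ : (f g : A → ℕ) (xs : List A) →
              sum (map (λ x → f x + g x) xs) ≡ sum (map f xs) + sum (map g xs)
  sum-map-+ f g []       = refl
  sum-map-+ f g (x ∷ xs) = trans (cong (f x + g x +_) (sum-map-+ f g xs))
                                 (interchange +-commutativeSemigroup (f x) (g x) _ _)

  sum-map-* : (k : ℕ) (f : A → ℕ) (xs : List A) →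
              sum (map (λ x → k * f x) xs) ≡ k * sum (map f xs)
  sum-map-* k f []       = sym (*-zeroʳ k)
  sum-map-* k f (x ∷ xs) = trans (cong (k * f x +_) (sum-map-* k f xs))
                                 (sym (*-distribˡ-+ k (f x) _))

  sum-map-++ : (f : A → ℕ) (xs ys : List A) →
               sum (map f (xs ++ ys)) ≡ sum (map f xs) + sum (map f ys)
  sum-map-++ f xs ys = trans (cong sum (map-++ f xs ys)) (sum-++ (map f xs) (map f ys))

  length-filterᵇ : (p : A → Bool) (xs : List A) →
                   length (filterᵇ p xs) ≡ sum (map (λ x → if p x then 1 else 0) xs)
  length-filterᵇ p []       = refl
  length-filterᵇ p (x ∷ xs) with p x
  ... | true  = cong suc (length-filterᵇ p xs)
  ... | false = length-filterᵇ p xs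

  filterᵇ-∧-filterᵇ : (p q : A → Bool) (xs : List A) →
                      filterᵇ (λ x → p x ∧ q x) (filterᵇ p xs) ≡ filterᵇ q (filterᵇ p xs)
  filterᵇ-∧-filterᵇ p q []       = refl
  filterᵇ-∧-filterᵇ p q (x ∷ xs) with p x in px
  ... | false = filterᵇ-∧-filterᵇ p q xs
  ... | true rewrite px with q x
  ...   | true  = cong (x ∷_) (filterᵇ-∧-filterᵇ p q xs)
  ...   | false = filterᵇ-∧-filterᵇ p q xs

  sum-map-filterᵇ : (p : A → Bool) (f : A → ℕ) → (∀ x → p x ≡ false → f x ≡ 0) →
                    (xs : List A) → sum (map f (filterᵇ p xs)) ≡ sum (map f xs)
  sum-map-filterᵇ p f f≡0 []       = refl
  sum-map-filterᵇ p f f≡0 (x ∷ xs) with p x in px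
  ... | true  = cong (f x +_) (sum-map-filterᵇ p f f≡0 xs)
  ... | false = trans (sum-map-filterᵇ p f f≡0 xs) (cong (_+ sum (map f xs)) (sym (f≡0 x px)))

module _ {A B : Set} where

  sum-map-map : (f : B → ℕ) (g : A → B) (xs : List A) →
                sum (map f (map g xs)) ≡ sum (map (f ∘ g) xs)
  sum-map-map f g xs = cong sum (sym (map-∘ xs))

  length-concatMap : (f : A → List B) (xs : List A) →
                     length (concatMap f xs) ≡ sum (map (length ∘ f) xs)
  length-concatMap f []       = refl
  length-concatMap f (x ∷ xs) =
    trans (length-++ (f x)) (cong (length (f x) +_) (length-concatMap f xs))

  sum-map-comm : (f : A → B → ℕ) (xs : List A) (ys : List B) →
                 sum (map (λ x → sum (map (f x) ys)) xs) ≡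
                 sum (map (λ y → sum (map (λ x → f x y) xs)) ys)
  sum-map-comm f []       ys = sym (sum-map-zero ys)
  sum-map-comm f (x ∷ xs) ys = trans (cong (sum (map (f x) ys) +_) (sum-map-comm f xs ys))
                                     (sym (sum-map-+ (f x) (λ y → sum (map (λ x → f x y) xs)) ys))

∣tabulate∣≡length-filterᵇ : ∀ {n} {A : Set} (p : A → Bool) (g : Fin n → A) →
                            ∣ Vec.tabulate (p ∘ g) ∣ ≡ length (filterᵇ p (List.tabulate g))
∣tabulate∣≡length-filterᵇ {zero}  p g = refl
∣tabulate∣≡length-filterᵇ {suc n} p g with p (g zero)
... | true  = cong suc (∣tabulate∣≡length-filterᵇ p (g ∘ suc))
... | false = ∣tabulate∣≡length-filterᵇ p (g ∘ suc)

fall-1 : ∀ a → fall a 1 ≡ a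
fall-1 zero    = refl
fall-1 (suc a) = cong suc (*-identityʳ a)

fall-2 : ∀ a → fall a 2 ≡ a * (a ∸ 1)
fall-2 zero    = refl
fall-2 (suc a) = cong (suc a *_) (fall-1 a)

-- (a)ₖ₊₁ = (a - k)·(a)ₖ, stated without subtraction.
fall-suc : ∀ a k → fall a (suc k) + k * fall a k ≡ a * fall a k
fall-suc zero    zero    = refl
fall-suc zero    (suc k) = *-zeroʳ (suc k)
fall-suc (suc a) zero    = +-identityʳ (suc a * 1)
fall-suc (suc a) (suc k) = begin
  suc a * fall a (suc k) + suc k * (suc a * fall a k) ≡⟨ regroup a k (fall a k) (fall a (suc k)) ⟩
  suc a * (fall a (suc k) + k * fall a k + fall a k)  ≡⟨ cong (λ t → suc a * (t + fall a k)) (fall-suc a k) ⟩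
  suc a * (a * fall a k + fall a k)                   ≡⟨ cong (suc a *_) (+-comm (a * fall a k) (fall a k)) ⟩
  suc a * (suc a * fall a k)                          ∎
  where
  open ≡-Reasoning
  regroup : ∀ a k f g → suc a * g + suc k * (suc a * f) ≡ suc a * (g + k * f + f)
  regroup = solve 4 (λ a k f g → (con 1 :+ a) :* g :+ (con 1 :+ k) :* ((con 1 :+ a) :* f)
                              := (con 1 :+ a) :* (g :+ k :* f :+ f)) refl

fall-pascal : ∀ a k → fall (suc a) (suc k) ≡ suc k * fall a k + fall a (suc k)
fall-pascal a k = begin
  fall a k + a * fall a k                    ≡⟨ cong (fall a k +_) (sym (fall-suc a k)) ⟩
  fall a k + (fall a (suc k) + k * fall a k) ≡⟨ regroup k (fall a k) (fall a (suc k)) ⟩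
  suc k * fall a k + fall a (suc k)          ∎
  where
  open ≡-Reasoning
  regroup : ∀ k f g → f + (g + k * f) ≡ suc k * f + g
  regroup = solve 3 (λ k f g → f :+ (g :+ k :* f) := (con 1 :+ k) :* f :+ g) refl

-- chains F E i counts the sequences F = F₀ ⊂ F₁ ⊂ ⋯ ⊂ Fᵢ = E of cofacet
-- steps: i! if F ⊆ E with |E ∖ F| = i, and 0 otherwise.  In the last clause
-- the first coordinate of E ∖ F is added at one of the i steps.
chains : ∀ {m} → Subset m → Subset m → ℕ → ℕ
chains []          []          zero    = 1
chains []          []          (suc i) = 0
chains (true  ∷ F) (true  ∷ E) i       = chains F E i
chains (false ∷ F) (false ∷ E) i       = chains F E i
chains (true  ∷ F) (false ∷ E) i       = 0
chains (false ∷ F) (true  ∷ E) zero    = 0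
chains (false ∷ F) (true  ∷ E) (suc i) = suc i * chains F E i

chains-refl : ∀ {m} (F : Subset m) → chains F F 0 ≡ 1
chains-refl []          = refl
chains-refl (true  ∷ F) = chains-refl F
chains-refl (false ∷ F) = chains-refl F

chains-≢ : ∀ {m} (F E : Subset m) → E ≢ F → chains F E 0 ≡ 0
chains-≢ []          []          E≢F = ⊥-elim (E≢F refl)
chains-≢ (true  ∷ F) (true  ∷ E) E≢F = chains-≢ F E (E≢F ∘ cong (true ∷_))
chains-≢ (false ∷ F) (false ∷ E) E≢F = chains-≢ F E (E≢F ∘ cong (false ∷_))
chains-≢ (true  ∷ F) (false ∷ E) E≢F = refl
chains-≢ (false ∷ F) (true  ∷ E) E≢F = refl

chains-zero : ∀ {m} (F E : Subset m) → chains F E 0 ≡ (if E ==ˢ F then 1 else 0)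
chains-zero F E with ≡-dec Bool._≟_ E F
... | yes refl = chains-refl F
... | no  E≢F  = chains-≢ F E E≢F

chains-≢0⇒∣F∣+i≡∣E∣ : ∀ {m} (F E : Subset m) i → chains F E i ≢ 0 → ∣ F ∣ + i ≡ ∣ E ∣
chains-≢0⇒∣F∣+i≡∣E∣ []          []          zero    c≢0 = refl
chains-≢0⇒∣F∣+i≡∣E∣ []          []          (suc i) c≢0 = ⊥-elim (c≢0 refl)
chains-≢0⇒∣F∣+i≡∣E∣ (true  ∷ F) (true  ∷ E) i       c≢0 = cong suc (chains-≢0⇒∣F∣+i≡∣E∣ F E i c≢0)
chains-≢0⇒∣F∣+i≡∣E∣ (false ∷ F) (false ∷ E) i       c≢0 = chains-≢0⇒∣F∣+i≡∣E∣ F E i c≢0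
chains-≢0⇒∣F∣+i≡∣E∣ (true  ∷ F) (false ∷ E) i       c≢0 = ⊥-elim (c≢0 refl)
chains-≢0⇒∣F∣+i≡∣E∣ (false ∷ F) (true  ∷ E) zero    c≢0 = ⊥-elim (c≢0 refl)
chains-≢0⇒∣F∣+i≡∣E∣ (false ∷ F) (true  ∷ E) (suc i) c≢0 =
  trans (+-suc ∣ F ∣ i) (cong suc (chains-≢0⇒∣F∣+i≡∣E∣ F E i (c≢0 ∘ scale-zero)))
  where
  scale-zero : chains F E i ≡ 0 → suc i * chains F E i ≡ 0
  scale-zero c≡0 = trans (cong (suc i *_) c≡0) (*-zeroʳ (suc i))

extensions : ∀ {m} → Subset m → List (Fin m) → List (Subset m)
extensions F js = map (λ j → F ∪ ⁅ j ⁆) (filterᵇ (λ j → not (lookup F j)) js)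

extensions-map-suc : ∀ {m} b (F : Subset m) js →
                     extensions (b ∷ F) (map suc js) ≡ map (b ∷_) (extensions F js)
extensions-map-suc b F []       = refl
extensions-map-suc b F (j ∷ js) with not (lookup F j)
... | true  = cong₂ _∷_ (cong (_∷ F ∪ ⁅ j ⁆) (∨-identityʳ b)) (extensions-map-suc b F js)
... | false = extensions-map-suc b F js

cofacets-∷ : ∀ {m} b (F : Subset m) → cofacets (b ∷ F) ≡ extensions (b ∷ F) (zero ∷ map suc (allFin m))
cofacets-∷ {m} b F = cong (λ js → extensions (b ∷ F) (zero ∷ js)) (sym (map-tabulate id suc))

sum-cofacets-true∷ : ∀ {m} (f : Subset (suc m) → ℕ) (F : Subset m) →
                     sum (map f (cofacets (true ∷ F))) ≡ sum (map (f ∘ (true ∷_)) (cofacets F))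
sum-cofacets-true∷ {m} f F = begin
  sum (map f (cofacets (true ∷ F)))
    ≡⟨ cong (sum ∘ map f) (cofacets-∷ true F) ⟩
  sum (map f (extensions (true ∷ F) (map suc (allFin m))))
    ≡⟨ cong (sum ∘ map f) (extensions-map-suc true F (allFin m)) ⟩
  sum (map f (map (true ∷_) (cofacets F)))
    ≡⟨ sum-map-map f (true ∷_) (cofacets F) ⟩
  sum (map (f ∘ (true ∷_)) (cofacets F))
    ∎
  where open ≡-Reasoning

sum-cofacets-false∷ : ∀ {m} (f : Subset (suc m) → ℕ) (F : Subset m) →
                      sum (map f (cofacets (false ∷ F))) ≡ f (true ∷ F) + sum (map (f ∘ (false ∷_)) (cofacets F))
sum-cofacets-false∷ {m} f F = begin
  sum (map f (cofacets (false ∷ F)))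
    ≡⟨ cong (sum ∘ map f) (cofacets-∷ false F) ⟩
  f ((false ∷ F) ∪ ⁅ zero ⁆) + sum (map f (extensions (false ∷ F) (map suc (allFin m))))
    ≡⟨ cong₂ (λ G Gs → f (true ∷ G) + sum (map f Gs)) (∪-identityʳ F) (extensions-map-suc false F (allFin m)) ⟩
  f (true ∷ F) + sum (map f (map (false ∷_) (cofacets F)))
    ≡⟨ cong (f (true ∷ F) +_) (sum-map-map f (false ∷_) (cofacets F)) ⟩
  f (true ∷ F) + sum (map (f ∘ (false ∷_)) (cofacets F))
    ∎
  where open ≡-Reasoning

sum-chains-cofacets : ∀ {m} i (F E : Subset m) →
                      sum (map (λ G → chains G E i) (cofacets F)) ≡ chains F E (suc i)
sum-chains-cofacets i [] [] = refl
sum-chains-cofacets i (true ∷ F) (true ∷ E) =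
  trans (sum-cofacets-true∷ (λ G → chains G (true ∷ E) i) F) (sum-chains-cofacets i F E)
sum-chains-cofacets i (true ∷ F) (false ∷ E) =
  trans (sum-cofacets-true∷ (λ G → chains G (false ∷ E) i) F) (sum-map-zero (cofacets F))
sum-chains-cofacets i (false ∷ F) (false ∷ E) =
  trans (sum-cofacets-false∷ (λ G → chains G (false ∷ E) i) F) (sum-chains-cofacets i F E)
sum-chains-cofacets zero (false ∷ F) (true ∷ E) =
  trans (sum-cofacets-false∷ (λ G → chains G (true ∷ E) 0) F) (cong (chains F E 0 +_) (sum-map-zero (cofacets F)))
sum-chains-cofacets (suc i) (false ∷ F) (true ∷ E) = begin
  sum (map (λ G → chains G (true ∷ E) (suc i)) (cofacets (false ∷ F)))
    ≡⟨ sum-cofacets-false∷ (λ G → chains G (true ∷ E) (suc i)) F ⟩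
  chains F E (suc i) + sum (map (λ G → suc i * chains G E i) (cofacets F))
    ≡⟨ cong (chains F E (suc i) +_) (sum-map-* (suc i) (λ G → chains G E i) (cofacets F)) ⟩
  chains F E (suc i) + suc i * sum (map (λ G → chains G E i) (cofacets F))
    ≡⟨ cong (λ t → chains F E (suc i) + suc i * t) (sum-chains-cofacets i F E) ⟩
  chains F E (suc i) + suc i * chains F E (suc i)
    ∎
  where open ≡-Reasoning

sum-allSubsets-suc : ∀ {m} (f : Subset (suc m) → ℕ) →
                     sum (map f (allSubsets (suc m))) ≡
                     sum (map (f ∘ (false ∷_)) (allSubsets m)) + sum (map (f ∘ (true ∷_)) (allSubsets m))
sum-allSubsets-suc {m} f =
  trans (sum-map-++ f (map (false ∷_) (allSubsets m)) (map (true ∷_) (allSubsets m)))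
        (cong₂ _+_ (sum-map-map f (false ∷_) (allSubsets m)) (sum-map-map f (true ∷_) (allSubsets m)))

sum-chains-allSubsets : ∀ {m} (E : Subset m) i →
                        sum (map (λ F → chains F E i) (allSubsets m)) ≡ fall ∣ E ∣ i
sum-chains-allSubsets []         zero    = refl
sum-chains-allSubsets []         (suc i) = refl
sum-chains-allSubsets {suc m} (false ∷ E) i =
  trans (sum-allSubsets-suc (λ F → chains F (false ∷ E) i))
        (trans (cong₂ _+_ (sum-chains-allSubsets E i) (sum-map-zero (allSubsets m))) (+-identityʳ _))
sum-chains-allSubsets {suc m} (true ∷ E) zero =
  trans (sum-allSubsets-suc (λ F → chains F (true ∷ E) 0))
        (cong₂ _+_ (sum-map-zero (allSubsets m)) (sum-chains-allSubsets E 0))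
sum-chains-allSubsets {suc m} (true ∷ E) (suc i) = begin
  sum (map (λ F → chains F (true ∷ E) (suc i)) (allSubsets (suc m)))
    ≡⟨ sum-allSubsets-suc (λ F → chains F (true ∷ E) (suc i)) ⟩
  sum (map (λ F → suc i * chains F E i) (allSubsets m)) + sum (map (λ F → chains F E (suc i)) (allSubsets m))
    ≡⟨ cong₂ _+_ (sum-map-* (suc i) (λ F → chains F E i) (allSubsets m)) (sum-chains-allSubsets E (suc i)) ⟩
  suc i * sum (map (λ F → chains F E i) (allSubsets m)) + fall (∣ E ∣) (suc i)
    ≡⟨ cong (λ s → suc i * s + fall (∣ E ∣) (suc i)) (sum-chains-allSubsets E i) ⟩
  suc i * fall (∣ E ∣) i + fall (∣ E ∣) (suc i)
    ≡⟨ sym (fall-pascal ∣ E ∣ i) ⟩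
  fall (suc (∣ E ∣)) (suc i)
    ∎
  where open ≡-Reasoning

2*m≡m+m : ∀ m → 2 * m ≡ m + m
2*m≡m+m m = cong (m +_) (+-identityʳ m)

2*m≤n⇒m≤n∸m : ∀ {m n} → 2 * m ≤ n → m ≤ n ∸ m
2*m≤n⇒m≤n∸m {m} 2m≤n = m+n≤o⇒m≤o∸n m (≤-trans (≤-reflexive (sym (2*m≡m+m m))) 2m≤n)

n≤2*m⇒n∸m≤m : ∀ {m n} → n ≤ 2 * m → n ∸ m ≤ m
n≤2*m⇒n∸m≤m {m} {n} n≤2m = m≤n+o⇒m∸n≤o n m (≤-trans n≤2m (≤-reflexive (2*m≡m+m m)))

m⊓n≤[m+n]/2 : ∀ m n → m ⊓ n ≤ (m + n) / 2
m⊓n≤[m+n]/2 m n = begin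
  m ⊓ n               ≡⟨ sym (m*n/n≡m (m ⊓ n) 2) ⟩
  m ⊓ n * 2 / 2       ≤⟨ /-monoˡ-≤ 2 twice-min≤sum ⟩
  (m + n) / 2         ∎
  where
  open ≤-Reasoning
  twice-min≤sum : m ⊓ n * 2 ≤ m + n
  twice-min≤sum = begin
    m ⊓ n * 2       ≡⟨ *-comm (m ⊓ n) 2 ⟩
    2 * (m ⊓ n)     ≡⟨ 2*m≡m+m (m ⊓ n) ⟩
    m ⊓ n + m ⊓ n   ≤⟨ +-mono-≤ (m⊓n≤m m n) (m⊓n≤n m n) ⟩
    m + n           ∎

module _ {d n : ℕ} (X : Family d n) where

  deg≡∣tabulate∣ : ∀ x → deg X x ≡ ∣ Vec.tabulate (mem X x) ∣
  deg≡∣tabulate∣ x = sym (∣tabulate∣≡length-filterᵇ (mem X x) id)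

  deg≤d+1 : ∀ x → deg X x ≤ suc d
  deg≤d+1 x = ≤-trans (≤-reflexive (deg≡∣tabulate∣ x)) (∣p∣≤n (Vec.tabulate (mem X x)))

  cardε≡deg⊓codeg : ∀ x → cardε X x ≡ deg X x ⊓ (suc d ∸ deg X x)
  cardε≡deg⊓codeg x with 2 * deg X x ≤ᵇ suc d | ≤ᵇ-reflects-≤ (2 * deg X x) (suc d)
  ... | true  | ofʸ 2g≤s = begin
    ∣ Vec.tabulate (mem X x) ∣          ≡⟨ sym (deg≡∣tabulate∣ x) ⟩
    deg X x                             ≡⟨ sym (m≤n⇒m⊓n≡m (2*m≤n⇒m≤n∸m 2g≤s)) ⟩
    deg X x ⊓ (suc d ∸ deg X x)         ∎
    where open ≡-Reasoning
  ... | false | ofⁿ 2g≰s = begin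
    ∣ Vec.tabulate (not ∘ mem X x) ∣    ≡⟨ cong ∣_∣ (tabulate-∘ not (mem X x)) ⟩
    ∣ ∁ (Vec.tabulate (mem X x)) ∣      ≡⟨ ∣∁p∣≡n∸∣p∣ (Vec.tabulate (mem X x)) ⟩
    suc d ∸ ∣ Vec.tabulate (mem X x) ∣  ≡⟨ cong (suc d ∸_) (sym (deg≡∣tabulate∣ x)) ⟩
    suc d ∸ deg X x                     ≡⟨ sym (m≥n⇒m⊓n≡n (n≤2*m⇒n∸m≤m (<⇒≤ (≰⇒> 2g≰s)))) ⟩
    deg X x ⊓ (suc d ∸ deg X x)         ∎
    where open ≡-Reasoning

  cardε≤[d+1]/2 : ∀ x → cardε X x ≤ suc d / 2
  cardε≤[d+1]/2 x = begin
    cardε X x                                   ≡⟨ cardε≡deg⊓codeg x ⟩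
    deg X x ⊓ (suc d ∸ deg X x)                 ≤⟨ m⊓n≤[m+n]/2 (deg X x) (suc d ∸ deg X x) ⟩
    (deg X x + (suc d ∸ deg X x)) / 2           ≡⟨ cong (_/ 2) (m+[n∸m]≡n (deg≤d+1 x)) ⟩
    suc d / 2                                   ∎
    where open ≤-Reasoning

  length-label : ∀ i F → length (label X i F) ≡ sum (map (λ x → chains F (ε X x) i) (unionList X))
  length-label zero F = begin
    length (filterᵇ (λ x → inUnion X x ∧ (ε X x ==ˢ F)) (unionList X))
      ≡⟨ cong length (filterᵇ-∧-filterᵇ (inUnion X) (λ x → ε X x ==ˢ F) (allFin n)) ⟩
    length (filterᵇ (λ x → ε X x ==ˢ F) (unionList X))
      ≡⟨ length-filterᵇ (λ x → ε X x ==ˢ F) (unionList X) ⟩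
    sum (map (λ x → if ε X x ==ˢ F then 1 else 0) (unionList X))
      ≡⟨ sum-map-cong (λ x → sym (chains-zero F (ε X x))) (unionList X) ⟩
    sum (map (λ x → chains F (ε X x) 0) (unionList X))
      ∎
    where open ≡-Reasoning
  length-label (suc i) F = begin
    length (concatMap (label X i) (cofacets F))
      ≡⟨ length-concatMap (label X i) (cofacets F) ⟩
    sum (map (length ∘ label X i) (cofacets F))
      ≡⟨ sum-map-cong (λ G → length-label i G) (cofacets F) ⟩
    sum (map (λ G → sum (map (λ x → chains G (ε X x) i) (unionList X))) (cofacets F))
      ≡⟨ sum-map-comm (λ G x → chains G (ε X x) i) (cofacets F) (unionList X) ⟩
    sum (map (λ x → sum (map (λ G → chains G (ε X x) i) (cofacets F))) (unionList X))
      ≡⟨ sum-map-cong (λ x → sum-chains-cofacets i F (ε X x)) (unionList X) ⟩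
    sum (map (λ x → chains F (ε X x) (suc i)) (unionList X))
      ∎
    where open ≡-Reasoning

  sum-chains-admissible : ∀ i x →
    sum (map (λ F → chains F (ε X x) i) (filterᵇ (admissible d i) (allSubsets (suc d)))) ≡ fall (cardε X x) i
  sum-chains-admissible i x =
    trans (sum-map-filterᵇ (admissible d i) (λ F → chains F (ε X x) i) chains≡0 (allSubsets (suc d)))
          (sum-chains-allSubsets (ε X x) i)
    where
    chains≡0 : ∀ F → admissible d i F ≡ false → chains F (ε X x) i ≡ 0
    chains≡0 F inadmissible with chains F (ε X x) i ℕ.≟ 0
    ... | yes c≡0 = c≡0
    ... | no  c≢0 = ⊥-elim (subst T inadmissible (≤⇒≤ᵇ ∣F∣+i≤[d+1]/2))
      where
      ∣F∣+i≤[d+1]/2 : ∣ F ∣ + i ≤ suc d / 2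
      ∣F∣+i≤[d+1]/2 = ≤-trans (≤-reflexive (chains-≢0⇒∣F∣+i≡∣E∣ F (ε X x) i c≢0)) (cardε≤[d+1]/2 x)

  Vol≡sum-fall : ∀ i → Vol X i ≡ sum (map (λ x → fall (cardε X x) i) (unionList X))
  Vol≡sum-fall i = begin
    sum (map (length ∘ label X i) admissibles)
      ≡⟨ sum-map-cong (length-label i) admissibles ⟩
    sum (map (λ F → sum (map (λ x → chains F (ε X x) i) (unionList X))) admissibles)
      ≡⟨ sum-map-comm (λ F x → chains F (ε X x) i) admissibles (unionList X) ⟩
    sum (map (λ x → sum (map (λ F → chains F (ε X x) i) admissibles)) (unionList X))
      ≡⟨ sum-map-cong (sum-chains-admissible i) (unionList X) ⟩
    sum (map (λ x → fall (cardε X x) i) (unionList X))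
      ∎
    where
    open ≡-Reasoning
    admissibles = filterᵇ (admissible d i) (allSubsets (suc d))

corollary3p5 : (d n : ℕ) (X : Family d n) →
    ((i : ℕ) → Vol X i ≡ sum (map (λ x → fall (cardε X x) i) (unionList X)))
    × (Vol X 0 ≡ length (unionList X))
    × (Vol X 1 ≡ sum (map (λ x → cardε X x) (unionList X)))
    × (sum (map (λ x → cardε X x) (unionList X)) ≡ symDiffCard X)
    × (Vol X 2 ≡ sum (map (λ x → cardε X x * dimε X x) (unionList X)))
corollary3p5 d n X =
  Vol≡sum-fall X ,
  trans (Vol≡sum-fall X 0) (sum-map-one (unionList X)) ,
  trans (Vol≡sum-fall X 1) (sum-map-cong (fall-1 ∘ cardε X) (unionList X)) ,
  sum-map-cong (cardε≡deg⊓codeg X) (unionList X) ,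
  trans (Vol≡sum-fall X 2) (sum-map-cong (fall-2 ∘ cardε X) (unionList X))
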